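{- Let $\varphi$ be a 3CNF formula and $\mathcal{P}_\varphi$ the system constructed from it. If $\varphi$ is not satisfiable, then the following transition system $T$ is a sound and complete reduced transition system for $\mathrm{TS}(\mathcal{P}_\varphi)$: $T$ has initial state $p_0$ with $p_0\xrightarrow{e}m_0$; for $i=1,\dots,n$, states $t_i,f_i,m_i$ with $m_{i-1}\xrightarrow{\theta_i}t_i\xrightarrow{\bar\lambda_i}m_i$ and $m_{i-1}\xrightarrow{\bar\theta_i}f_i\xrightarrow{\lambda_i}m_i$; for $j=1,\dots,k$, transitions from $m_{n+j-1}$ to $m_{n+j}$ labelled by the action of each literal $\alpha^j_1,\alpha^j_2,\alpha^j_3$ of clause $j$; and $m_{n+k}\xrightarrow{b}m_{n+k+1}$.
   Context: Let $\varphi=(\alpha^1_1\lor\alpha^1_2\lor\alpha^1_3)\land\dots\land(\alpha^k_1\lor\alpha^k_2\lor\alpha^k_3)$ be a 3CNF formula over variables $x_1,\dots,x_n$, each $\alpha^j_i$ a literal $x_m$ or $\bar x_m$; the action of literal $x_m$ is $x_m$ and of $\bar x_m$ is $\bar x_m$. The system $\mathcal{P}_\varphi$ is a finite collection of transition systems synchronizing on common actions, with actions $\theta_i,\lambda_i,\bar\theta_i,\bar\lambda_i,x_i,\bar x_i$ ($i=1,\dots,n$), $e,\bar e,b$, and the processes: - For each $i$, $C_i$ with states top, bottom: top $\xrightarrow{\theta_i}$ bottom, top $\xrightarrow{\lambda_i}$ bottom, bottom $\xrightarrow{x_i}$ bottom; and $\bar C_i$ likewise with $\bar\theta_i,\bar\lambda_i,\bar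 x_i$. Initially in top. - $C^*$ with a single transition labelled $e$; $\bar C^*$ with a path $\xrightarrow{b}\xrightarrow{\bar e}$. - $S_l$: states $l_0,\dots,l_{n+1}$, with $l_0\xrightarrow{e}l_1$, $l_0\xrightarrow{\bar e}l_1$, and $l_i\xrightarrow{\lambda_i}l_{i+1}$, $l_i\xrightarrow{\bar\lambda_i}l_{i+1}$ for $i=1,\dots,n$; initially $l_0$. - $S_r$: states $r_0,\dots,r_{n+k+1}$, with $r_{i-1}\xrightarrow{\theta_i}r_i$, $r_{i-1}\xrightarrow{\bar\theta_i}r_i$ for $i=1,\dots,n$; for $j=1,\dots,k$, transitions from $r_{n+j-1}$ to $r_{n+j}$ labelled by the actions of the literals of clause $j$; and $r_{n+k}\xrightarrow{b}r_{n+k+1}$; initially $r_0$. $\mathit{dom}(a)$ is the set of processes having $a$ in their alphabet. The global transition system $\mathrm{TS}(\mathcal{P}_\varphi)$ has states the tuples of local states, initial state the tuple of initial states, and $s\xrightarrow{a}s'$ iff every process in $\mathit{dom}(a)$ takes an $a$-transition and the others stay put. A full run is a path from the initial state to a state without outgoing transitions. Actions are independent if their domains are disjoint; $u\sim w$ if $w$ is obtained from $u$ by swapping adjacent independent actions. A transition system $T$ is a sound and complete reduced transition system for $\mathrm{TS}(\mathcal{P}_\varphi)$ if every full run of $T$ is a full run of $\mathrm{TS}(\mathcal{P}_\varphi)$, and for every full run $u$ of $\mathrm{TS}(\mathcal{P}_\varphi)$ there is a full run $v$ of $T$ with $v\sim u$. -}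

module Defs where

open import Data.Nat using (ℕ; zero; suc; _+_)
open import Data.Fin using (Fin; toℕ)
open import Data.Bool using (Bool; true; false; not)
open import Data.List using (List; []; _∷_; _++_)
open import Data.Product using (Σ; ∃; _×_; _,_)
open import Data.Empty using (⊥)
open import Relation.Nullary using (¬_)
open import Relation.Binary.PropositionalEquality using (_≡_)
open import Relation.Binary.Construct.Closure.ReflexiveTransitive using (Star)

-- 3CNF formulas over variables x_1..x_n (represented by Fin n, 0-based)

data Lit (n : ℕ) : Set where
  pos : Fin n → Lit n
  neg : Fin n → Lit n

Formula : ℕ → ℕ → Set
Formula n k = Fin k → Fin 3 → Lit n

evalLit : {n : ℕ} → (Fin n → Bool) → Lit n → Bool
evalLit σ (pos m) = σ m
evalLit σ (neg m) = not (σ m)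

Satisfiable : {n k : ℕ} → Formula n k → Set
Satisfiable {n} {k} φ =
  Σ (Fin n → Bool) λ σ → (j : Fin k) → Σ (Fin 3) λ q → evalLit σ (φ j q) ≡ true

-- Actions (variable index i : Fin n stands for i+1 in the paper)

data Act (n : ℕ) : Set where
  theta thetab lam lamb xp xn : Fin n → Act n
  e eb b : Act n

litAct : {n : ℕ} → Lit n → Act n
litAct (pos m) = xp m
litAct (neg m) = xn m

data Path {S A : Set} (Step : S → A → S → Set) : S → List A → S → Set where
  done : ∀ {s} → Path Step s [] s
  step : ∀ {s a s' u s''} → Step s a s' → Path Step s' u s'' → Path Step s (a ∷ u) s''

FullRun : {S A : Set} → (Step : S → A → S → Set) → S → List A → Set
FullRun {S} {A} Step s₀ u =
  Σ S λ s → Path Step s₀ u s × ((a : A) (s' : S) → ¬ Step s a s')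

data Proc (n : ℕ) : Set where
  C Cb : Fin n → Proc n
  Cstar Cbstar Sl Sr : Proc n

data Alph {n : ℕ} : Proc n → Act n → Set where
  C-theta   : ∀ i → Alph (C i) (theta i)
  C-lam     : ∀ i → Alph (C i) (lam i)
  C-x       : ∀ i → Alph (C i) (xp i)
  Cb-theta  : ∀ i → Alph (Cb i) (thetab i)
  Cb-lam    : ∀ i → Alph (Cb i) (lamb i)
  Cb-x      : ∀ i → Alph (Cb i) (xn i)
  Cstar-e   : Alph Cstar e
  Cbstar-b  : Alph Cbstar b
  Cbstar-eb : Alph Cbstar eb
  Sl-e      : Alph Sl e
  Sl-eb     : Alph Sl eb
  Sl-lam    : ∀ i → Alph Sl (lam i)
  Sl-lamb   : ∀ i → Alph Sl (lamb i)
  Sr-theta  : ∀ i → Alph Sr (theta i)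
  Sr-thetab : ∀ i → Alph Sr (thetab i)
  Sr-xp     : ∀ i → Alph Sr (xp i)
  Sr-xn     : ∀ i → Alph Sr (xn i)
  Sr-b      : Alph Sr b

data CState : Set where
  top bottom : CState

data CsState : Set where
  c0 c1 : CsState

data CbsState : Set where
  d0 d1 d2 : CbsState

LState : {n : ℕ} → ℕ → Proc n → Set
LState k (C i)  = CState
LState k (Cb i) = CState
LState k Cstar  = CsState
LState k Cbstar = CbsState
LState {n} k Sl = Fin (suc (suc n))
LState {n} k Sr = Fin (suc (suc (n + k)))

initL : {n : ℕ} (k : ℕ) (p : Proc n) → LState k p
initL k (C i)  = top
initL k (Cb i) = top
initL k Cstar  = c0
initL k Cbstar = d0
initL k Sl     = Fin.zero
initL k Sr     = Fin.zero

data CStep {n : ℕ} (th lm x : Act n) : CState → Act n → CState → Set where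
  c-th : CStep th lm x top th bottom
  c-lm : CStep th lm x top lm bottom
  c-x  : CStep th lm x bottom x bottom

data CsStep {n : ℕ} : CsState → Act n → CsState → Set where
  cs-e : CsStep c0 e c1

data CbsStep {n : ℕ} : CbsState → Act n → CbsState → Set where
  cbs-b  : CbsStep d0 b d1
  cbs-eb : CbsStep d1 eb d2

data SlStep {n : ℕ} : Fin (suc (suc n)) → Act n → Fin (suc (suc n)) → Set where
  sl-e    : ∀ {j j'} → toℕ j ≡ 0 → toℕ j' ≡ 1 → SlStep j e j'
  sl-eb   : ∀ {j j'} → toℕ j ≡ 0 → toℕ j' ≡ 1 → SlStep j eb j'
  sl-lam  : ∀ i {j j'} → toℕ j ≡ suc (toℕ i) → toℕ j' ≡ suc (suc (toℕ i)) → SlStep j (lam i) j'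
  sl-lamb : ∀ i {j j'} → toℕ j ≡ suc (toℕ i) → toℕ j' ≡ suc (suc (toℕ i)) → SlStep j (lamb i) j'

data SrStep {n k : ℕ} (φ : Formula n k) : Fin (suc (suc (n + k))) → Act n → Fin (suc (suc (n + k))) → Set where
  sr-theta  : ∀ i {j j'} → toℕ j ≡ toℕ i → toℕ j' ≡ suc (toℕ i) → SrStep φ j (theta i) j'
  sr-thetab : ∀ i {j j'} → toℕ j ≡ toℕ i → toℕ j' ≡ suc (toℕ i) → SrStep φ j (thetab i) j'
  sr-clause : ∀ (c : Fin k) (q : Fin 3) {j j'} → toℕ j ≡ n + toℕ c → toℕ j' ≡ suc (n + toℕ c) →
              SrStep φ j (litAct (φ c q)) j'
  sr-b      : ∀ {j j'} → toℕ j ≡ n + k → toℕ j' ≡ suc (n + k) → SrStep φ j b j'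

LStep : {n k : ℕ} → Formula n k → (p : Proc n) → LState k p → Act n → LState k p → Set
LStep φ (C i)  = CStep (theta i) (lam i) (xp i)
LStep φ (Cb i) = CStep (thetab i) (lamb i) (xn i)
LStep φ Cstar  = CsStep
LStep φ Cbstar = CbsStep
LStep φ Sl     = SlStep
LStep φ Sr     = SrStep φ

GState : ℕ → ℕ → Set
GState n k = (p : Proc n) → LState k p

GInit : (n k : ℕ) → GState n k
GInit n k = initL k

GStep : {n k : ℕ} → Formula n k → GState n k → Act n → GState n k → Set
GStep φ s a s' = (p : Proc _) →
  (Alph p a → LStep φ p (s p) a (s' p)) × (¬ Alph p a → s' p ≡ s p)

Indep : {n : ℕ} → Act n → Act n → Set
Indep {n} a c = (p : Proc n) → Alph p a → Alph p c → ⊥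

data Swap {n : ℕ} : List (Act n) → List (Act n) → Set where
  swap : ∀ u a c w → Indep a c → Swap (u ++ a ∷ c ∷ w) (u ++ c ∷ a ∷ w)

_∼_ : {n : ℕ} → List (Act n) → List (Act n) → Set
_∼_ = Star Swap

SoundComplete : {n k : ℕ} (φ : Formula n k) {S : Set} → (S → Act n → S → Set) → S → Set
SoundComplete {n} {k} φ TStep t₀ =
  ((u : List (Act n)) → FullRun TStep t₀ u → FullRun (GStep φ) (GInit n k) u) ×
  ((u : List (Act n)) → FullRun (GStep φ) (GInit n k) u →
     Σ (List (Act n)) λ v → FullRun TStep t₀ v × (v ∼ u))

data TState (n k : ℕ) : Set where
  p0 : TState n k
  m  : Fin (suc (suc (n + k))) → TState n k
  t f : Fin n → TState n k

data TStep {n k : ℕ} (φ : Formula n k) : TState n k → Act n → TState n k → Set where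
  T-e      : ∀ {j} → toℕ j ≡ 0 → TStep φ p0 e (m j)
  T-theta  : ∀ i {j} → toℕ j ≡ toℕ i → TStep φ (m j) (theta i) (t i)
  T-lamb   : ∀ i {j} → toℕ j ≡ suc (toℕ i) → TStep φ (t i) (lamb i) (m j)
  T-thetab : ∀ i {j} → toℕ j ≡ toℕ i → TStep φ (m j) (thetab i) (f i)
  T-lam    : ∀ i {j} → toℕ j ≡ suc (toℕ i) → TStep φ (f i) (lam i) (m j)
  T-clause : ∀ (c : Fin k) (q : Fin 3) {j j'} → toℕ j ≡ n + toℕ c → toℕ j' ≡ suc (n + toℕ c) →
             TStep φ (m j) (litAct (φ c q)) (m j')
  T-b      : ∀ {j j'} → toℕ j ≡ n + k → toℕ j' ≡ suc (n + k) → TStep φ (m j) b (m j')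

module Submission where

open import Defs
open import Data.Nat using (ℕ; zero; suc; _+_; _∸_; _⊓_; _≤_; _<_; z≤n; s≤s; z<s; _≟_)
open import Data.Nat.Properties
open import Data.Fin using (Fin; toℕ; fromℕ<) renaming (zero to fz; suc to fs)
open import Data.Fin.Properties using (toℕ-injective; toℕ<n; toℕ-fromℕ<) renaming (_≟_ to _≟ᶠ_)
open import Data.Bool using (Bool; true; false)
open import Data.List using (List; []; _∷_; _++_; _∷ʳ_; length; drop)
open import Data.List.Properties using (++-assoc; ++-identityʳ; length-++; drop-all)
open import Data.List.Relation.Unary.All as All using (All; []; _∷_)
open import Data.List.Relation.Unary.All.Properties using (drop⁺; ++⁺)
open import Data.List.Relation.Unary.Any using (here; there)
open import Data.List.Membership.Propositional using (_∈_)
open import Data.Product using (Σ; _×_; _,_; proj₁; proj₂)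
open import Data.Sum using (_⊎_; inj₁; inj₂)
open import Data.Empty using (⊥; ⊥-elim)
open import Function using (case_of_)
open import Relation.Nullary using (¬_; Dec; yes; no)
open import Relation.Nullary.Decidable using (map′)
open import Relation.Binary.PropositionalEquality
open import Relation.Binary.Construct.Closure.ReflexiveTransitive using (ε; _◅_; _◅◅_; gmap)

-- Every action belongs to exactly one of S_l and S_r, so a run interleaves the word of S_l
-- (e, then λ_i or λ̄_i for each i) with the word of S_r (θ_i or θ̄_i for each i, a literal per
-- clause, then b).  ē needs b before any move of S_l; the C_i at bottom would then form an
-- assignment passing every clause, so for unsatisfiable φ the word of S_l starts with e.
-- Along a run we maintain that the number of C_i, C̄_i at bottom is the number of S_l, S_r
-- past position i, and that every executed action has left its C-processes at bottom.  A θ-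
-- or λ-move needs its C-process at top, so it is independent of all moves the other side has
-- already made.  Hence each new move can be commuted into place in the alternating word
-- e r₀ l₀ r₁ l₁ … (literal moves and b sit after all λ-moves), where independence forces l_i
-- to be the complement of r_i, making the word a run of T.  Conversely, the global system
-- follows T step by step under the same invariant.

length-∷ʳ : {A : Set} (xs : List A) (x : A) → length (xs ∷ʳ x) ≡ suc (length xs)
length-∷ʳ xs x = trans (length-++ xs) (+-comm (length xs) 1)

alternate : {A : Set} → List A → List A → List A
alternate []       ys       = ys
alternate (x ∷ xs) []       = x ∷ xs
alternate (x ∷ xs) (y ∷ ys) = x ∷ y ∷ alternate xs ys

alternate-[]ʳ : {A : Set} (xs : List A) → alternate xs [] ≡ xs
alternate-[]ʳ []       = refl
alternate-[]ʳ (x ∷ xs) = refl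

Indep-sym : ∀ {n} {a c : Act n} → Indep a c → Indep c a
Indep-sym ind p c∈p a∈p = ind p a∈p c∈p

module _ {n : ℕ} where

  ∼-∷ : (a : Act n) {u w : List (Act n)} → u ∼ w → (a ∷ u) ∼ (a ∷ w)
  ∼-∷ a = gmap (a ∷_) λ { (swap u c d w ind) → swap (a ∷ u) c d w ind }

  ∼-++ʳ : (z : List (Act n)) {u w : List (Act n)} → u ∼ w → (u ++ z) ∼ (w ++ z)
  ∼-++ʳ z = gmap (_++ z) λ { (swap u c d w ind) →
    subst₂ Swap (sym (++-assoc u (c ∷ d ∷ w) z)) (sym (++-assoc u (d ∷ c ∷ w) z)) (swap u c d (w ++ z) ind) }

  ∼-commute-to-end : (a : Act n) (xs : List (Act n)) → All (Indep a) xs → (a ∷ xs) ∼ (xs ∷ʳ a)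
  ∼-commute-to-end a []       []         = ε
  ∼-commute-to-end a (x ∷ xs) (ind ∷ is) = swap [] a x xs ind ◅ ∼-∷ x (∼-commute-to-end a xs is)

  alternate-∷ʳ₁ : (r : Act n) (rs ls : List (Act n)) → All (Indep r) (drop (length rs) ls) →
                  alternate (rs ∷ʳ r) ls ∼ (alternate rs ls ∷ʳ r)
  alternate-∷ʳ₁ r []       []       _   = ε
  alternate-∷ʳ₁ r []       (l ∷ ls) ind = ∼-commute-to-end r (l ∷ ls) ind
  alternate-∷ʳ₁ r (x ∷ xs) []       _   = ε
  alternate-∷ʳ₁ r (x ∷ xs) (l ∷ ls) ind = ∼-∷ x (∼-∷ l (alternate-∷ʳ₁ r xs ls ind))

  alternate-∷ʳ₂ : (l : Act n) (rs ls : List (Act n)) → All (Indep l) (drop (suc (length ls)) rs) →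
                  alternate rs (ls ∷ʳ l) ∼ (alternate rs ls ∷ʳ l)
  alternate-∷ʳ₂ l []       []       _   = ε
  alternate-∷ʳ₂ l []       (y ∷ ys) _   = ε
  alternate-∷ʳ₂ l (x ∷ xs) []       ind rewrite alternate-[]ʳ xs = ∼-∷ x (∼-commute-to-end l xs ind)
  alternate-∷ʳ₂ l (x ∷ xs) (y ∷ ys) ind = ∼-∷ x (∼-∷ y (alternate-∷ʳ₂ l xs ys ind))

data Along {A : Set} (M : ℕ → A → Set) : ℕ → List A → Set where
  []  : ∀ {P} → Along M P []
  _∷_ : ∀ {P x xs} → M P x → Along M (suc P) xs → Along M P (x ∷ xs)

module _ {A : Set} {M : ℕ → A → Set} where

  reindex-+0 : ∀ {P x} → M (P + 0) x → M P x
  reindex-+0 {P} {x} = subst (λ Q → M Q x) (+-identityʳ P)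

  reindex-+suc : ∀ {P L x} → M (P + suc L) x → M (suc P + L) x
  reindex-+suc {P} {L} {x} = subst (λ Q → M Q x) (+-suc P L)

  Along-∷ʳ : ∀ {P xs x} → Along M P xs → M (P + length xs) x → Along M P (xs ∷ʳ x)
  Along-∷ʳ []       mx = reindex-+0 mx ∷ []
  Along-∷ʳ (y ∷ ys) mx = y ∷ Along-∷ʳ ys (reindex-+suc mx)

  Along-All : {R Q : A → Set} → (∀ {P x} → M P x → R x → Q x) →
              ∀ {P xs} → Along M P xs → All R xs → All Q xs
  Along-All h []         []       = []
  Along-All h (mx ∷ mxs) (r ∷ rs) = h mx r ∷ Along-All h mxs rs

  Along-at : ∀ {P Q xs} → Along M P xs → P ≤ Q → Q < P + length xs → Σ A λ x → M Q x × x ∈ xs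
  Along-at {P} {Q} [] P≤Q Q< = ⊥-elim (<⇒≱ Q< (subst (_≤ Q) (sym (+-identityʳ P)) P≤Q))
  Along-at {P} {Q} {x ∷ xs} (mx ∷ mxs) P≤Q Q< with P ≟ Q
  ... | yes refl = x , mx , here refl
  ... | no  P≢Q
    with y , my , y∈ ← Along-at mxs (≤∧≢⇒< P≤Q P≢Q) (subst (Q <_) (+-suc P (length xs)) Q<)
    = y , my , there y∈

  Along-length : ∀ {N} → (∀ {P x} → M P x → P < N) → ∀ {P xs} → Along M P xs → P ≤ N → P + length xs ≤ N
  Along-length {N} bound {P} []                  P≤N = subst (_≤ N) (sym (+-identityʳ P)) P≤N
  Along-length {N} bound {P} {_ ∷ xs} (mx ∷ mxs) _   =
    subst (_≤ N) (sym (+-suc P (length xs))) (Along-length bound mxs (bound mx))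

toℕ≢≥ : ∀ {n} (i : Fin n) {j} → n ≤ j → toℕ i ≢ j
toℕ≢≥ {n} i n≤j i≡j = <⇒≱ (toℕ<n i) (subst (n ≤_) (sym i≡j) n≤j)

next : ∀ {N} → Fin (suc N) → Fin (suc N)
next {zero}  j      = j
next {suc N} fz     = fs fz
next {suc N} (fs j) = fs (next j)

toℕ-next : ∀ {N} (j : Fin (suc N)) → toℕ j < N → toℕ (next j) ≡ suc (toℕ j)
toℕ-next {suc N} fz     _         = refl
toℕ-next {suc N} (fs j) (s≤s j<N) = cong suc (toℕ-next j j<N)

passed : ℕ → ℕ → ℕ
passed _       zero    = 0
passed zero    (suc _) = 1
passed (suc i) (suc j) = passed i j

passed-self : ∀ i → passed i i ≡ 0
passed-self zero    = refl
passed-self (suc i) = passed-self i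

passed-suc-self : ∀ i → passed i (suc i) ≡ 1
passed-suc-self zero    = refl
passed-suc-self (suc i) = passed-suc-self i

passed-suc-≢ : ∀ i j → i ≢ j → passed i (suc j) ≡ passed i j
passed-suc-≢ zero    zero    i≢j = ⊥-elim (i≢j refl)
passed-suc-≢ zero    (suc j) _   = refl
passed-suc-≢ (suc i) zero    _   = refl
passed-suc-≢ (suc i) (suc j) i≢j = passed-suc-≢ i j (λ i≡j → i≢j (cong suc i≡j))

passed-< : ∀ {i j} → i < j → passed i j ≡ 1
passed-< {zero}  {suc j} _         = refl
passed-< {suc i} {suc j} (s≤s i<j) = passed-< i<j

passed-≥ : ∀ {i j} → j ≤ i → passed i j ≡ 0
passed-≥ {i}     {zero}  _         = refl
passed-≥ {suc i} {suc j} (s≤s j≤i) = passed-≥ j≤i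

passed≤1 : ∀ i j → passed i j ≤ 1
passed≤1 _       zero    = z≤n
passed≤1 zero    (suc _) = s≤s z≤n
passed≤1 (suc i) (suc j) = passed≤1 i j

passed-tickˡ : ∀ {x y c} i j → (i ≡ j → y ≡ suc x) → (i ≢ j → y ≡ x) →
               x ≡ passed i j + c → y ≡ passed i (suc j) + c
passed-tickˡ i j grow same x≡ with i ≟ j
... | yes refl rewrite grow refl | x≡ | passed-self i | passed-suc-self i = refl
... | no  i≢j  = trans (same i≢j) (trans x≡ (cong (_+ _) (sym (passed-suc-≢ i j i≢j))))

passed-tickʳ : ∀ {x y c} i j → (i ≡ j → y ≡ suc x) → (i ≢ j → y ≡ x) →
               x ≡ c + passed i j → y ≡ c + passed i (suc j)
passed-tickʳ {c = c} i j grow same x≡ =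
  trans (passed-tickˡ i j grow same (trans x≡ (+-comm c _))) (+-comm _ c)

isBot : CState → ℕ
isBot top    = 0
isBot bottom = 1

isBottom : CState → Bool
isBottom top    = false
isBottom bottom = true

top≢bottom : ∀ {x} → x ≡ top → x ≢ bottom
top≢bottom refl ()

isBot-sum≡0 : ∀ x y → isBot x + isBot y ≡ 0 → x ≡ top × y ≡ top
isBot-sum≡0 top top _ = refl , refl

isBot-sum≡2 : ∀ x y → isBot x + isBot y ≡ 2 → x ≡ bottom × y ≡ bottom
isBot-sum≡2 bottom bottom _ = refl , refl
isBot-sum≡2 top    top    ()
isBot-sum≡2 top    bottom ()
isBot-sum≡2 bottom top    ()

isBot-sum≤1 : ∀ x y → isBot x + isBot y ≤ 1 → x ≡ top ⊎ y ≡ top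
isBot-sum≤1 top    _      _       = inj₁ refl
isBot-sum≤1 bottom top    _       = inj₂ refl
isBot-sum≤1 bottom bottom (s≤s ())

other-top-right : ∀ {x y} → x ≡ top ⊎ y ≡ top → x ≡ bottom → y ≡ top
other-top-right (inj₁ refl) ()
other-top-right (inj₂ y≡)   _ = y≡

other-top-left : ∀ {x y} → x ≡ top ⊎ y ≡ top → y ≡ bottom → x ≡ top
other-top-left (inj₁ x≡)   _  = x≡
other-top-left (inj₂ refl) ()

Sl-or-Sr : ∀ {n} (a : Act n) → Alph Sl a ⊎ Alph Sr a
Sl-or-Sr (theta i)  = inj₂ (Sr-theta i)
Sl-or-Sr (thetab i) = inj₂ (Sr-thetab i)
Sl-or-Sr (lam i)    = inj₁ (Sl-lam i)
Sl-or-Sr (lamb i)   = inj₁ (Sl-lamb i)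
Sl-or-Sr (xp i)     = inj₂ (Sr-xp i)
Sl-or-Sr (xn i)     = inj₂ (Sr-xn i)
Sl-or-Sr e          = inj₁ Sl-e
Sl-or-Sr eb         = inj₁ Sl-eb
Sl-or-Sr b          = inj₂ Sr-b

alph? : {n : ℕ} (p : Proc n) (a : Act n) → Dec (Alph p a)
alph? (C i)  (theta j)  = map′ (λ { refl → C-theta i })  (λ { (C-theta _) → refl })  (i ≟ᶠ j)
alph? (C i)  (lam j)    = map′ (λ { refl → C-lam i })    (λ { (C-lam _) → refl })    (i ≟ᶠ j)
alph? (C i)  (xp j)     = map′ (λ { refl → C-x i })      (λ { (C-x _) → refl })      (i ≟ᶠ j)
alph? (C i)  (thetab j) = no λ ()
alph? (C i)  (lamb j)   = no λ ()
alph? (C i)  (xn j)     = no λ ()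
alph? (C i)  e          = no λ ()
alph? (C i)  eb         = no λ ()
alph? (C i)  b          = no λ ()
alph? (Cb i) (thetab j) = map′ (λ { refl → Cb-theta i }) (λ { (Cb-theta _) → refl }) (i ≟ᶠ j)
alph? (Cb i) (lamb j)   = map′ (λ { refl → Cb-lam i })   (λ { (Cb-lam _) → refl })   (i ≟ᶠ j)
alph? (Cb i) (xn j)     = map′ (λ { refl → Cb-x i })     (λ { (Cb-x _) → refl })     (i ≟ᶠ j)
alph? (Cb i) (theta j)  = no λ ()
alph? (Cb i) (lam j)    = no λ ()
alph? (Cb i) (xp j)     = no λ ()
alph? (Cb i) e          = no λ ()
alph? (Cb i) eb         = no λ ()
alph? (Cb i) b          = no λ ()
alph? Cstar  e          = yes Cstar-e
alph? Cstar  (theta j)  = no λ ()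
alph? Cstar  (thetab j) = no λ ()
alph? Cstar  (lam j)    = no λ ()
alph? Cstar  (lamb j)   = no λ ()
alph? Cstar  (xp j)     = no λ ()
alph? Cstar  (xn j)     = no λ ()
alph? Cstar  eb         = no λ ()
alph? Cstar  b          = no λ ()
alph? Cbstar b          = yes Cbstar-b
alph? Cbstar eb         = yes Cbstar-eb
alph? Cbstar (theta j)  = no λ ()
alph? Cbstar (thetab j) = no λ ()
alph? Cbstar (lam j)    = no λ ()
alph? Cbstar (lamb j)   = no λ ()
alph? Cbstar (xp j)     = no λ ()
alph? Cbstar (xn j)     = no λ ()
alph? Cbstar e          = no λ ()
alph? Sl     e          = yes Sl-e
alph? Sl     eb         = yes Sl-eb
alph? Sl     (lam j)    = yes (Sl-lam j)
alph? Sl     (lamb j)   = yes (Sl-lamb j)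
alph? Sl     (theta j)  = no λ ()
alph? Sl     (thetab j) = no λ ()
alph? Sl     (xp j)     = no λ ()
alph? Sl     (xn j)     = no λ ()
alph? Sl     b          = no λ ()
alph? Sr     (theta j)  = yes (Sr-theta j)
alph? Sr     (thetab j) = yes (Sr-thetab j)
alph? Sr     (xp j)     = yes (Sr-xp j)
alph? Sr     (xn j)     = yes (Sr-xn j)
alph? Sr     b          = yes Sr-b
alph? Sr     (lam j)    = no λ ()
alph? Sr     (lamb j)   = no λ ()
alph? Sr     e          = no λ ()
alph? Sr     eb         = no λ ()

module Pφ (n k : ℕ) (φ : Formula n k) where

  Global : Set
  Global = GState n k

  Pos : Set
  Pos = Fin (suc (suc (n + k)))

  advance : (p : Proc n) → LState k p → LState k p
  advance (C i)  _  = bottom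
  advance (Cb i) _  = bottom
  advance Cstar  _  = c1
  advance Cbstar d0 = d1
  advance Cbstar _  = d2
  advance Sl     j  = next j
  advance Sr     j  = next j

  fire : Global → Act n → Global
  fire s a p with alph? p a
  ... | yes _ = advance p (s p)
  ... | no  _ = s p

  fire-step : (s : Global) (a : Act n) → (∀ p → Alph p a → LStep φ p (s p) a (advance p (s p))) →
              GStep φ s a (fire s a)
  fire-step s a enabled p with alph? p a
  ... | yes a∈p = (λ _ → enabled p a∈p) , (λ a∉p → ⊥-elim (a∉p a∈p))
  ... | no  a∉p = (λ a∈p → ⊥-elim (a∉p a∈p)) , (λ _ → refl)

  record Settled (s : Global) (a : Act n) : Set where
    field
      C-settled  : ∀ i → Alph (C i) a → s (C i) ≡ bottom
      Cb-settled : ∀ i → Alph (Cb i) a → s (Cb i) ≡ bottom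
  open Settled

  bottoms : Global → Fin n → ℕ
  bottoms s i = isBot (s (C i)) + isBot (s (Cb i))

  -- The graph of litAct, so that RMove can be inverted by pattern matching.
  data _↦_ : Lit n → Act n → Set where
    pos : ∀ i → pos i ↦ xp i
    neg : ∀ i → neg i ↦ xn i

  ↦-litAct : ∀ l → l ↦ litAct l
  ↦-litAct (pos i) = pos i
  ↦-litAct (neg i) = neg i

  ↦⇒litAct : ∀ {l a} → l ↦ a → litAct l ≡ a
  ↦⇒litAct (pos _) = refl
  ↦⇒litAct (neg _) = refl

  -- S_l makes its move LMove P from l_{P+1}, S_r its move RMove P from r_P.
  data LMove : ℕ → Act n → Set where
    lam-at  : ∀ {P} i → toℕ i ≡ P → LMove P (lam i)
    lamb-at : ∀ {P} i → toℕ i ≡ P → LMove P (lamb i)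

  data RMove : ℕ → Act n → Set where
    theta-at   : ∀ {P} i → toℕ i ≡ P → RMove P (theta i)
    thetab-at  : ∀ {P} i → toℕ i ≡ P → RMove P (thetab i)
    literal-at : ∀ {P a} c q → φ c q ↦ a → n + toℕ c ≡ P → RMove P a
    b-at       : ∀ {P} → P ≡ n + k → RMove P b

  LWord RWord : ℕ → List (Act n) → Set
  LWord = Along LMove
  RWord = Along RMove

  data Matched : ℕ → List (Act n) → List (Act n) → Set where
    left-only  : ∀ {P ls} → LWord P ls → Matched P [] ls
    right-only : ∀ {P rs} → RWord P rs → Matched P rs []
    theta-lamb : ∀ {P i rs ls} → toℕ i ≡ P → Matched (suc P) rs ls →
                 Matched P (theta i ∷ rs) (lamb i ∷ ls)
    thetab-lam : ∀ {P i rs ls} → toℕ i ≡ P → Matched (suc P) rs ls →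
                 Matched P (thetab i ∷ rs) (lam i ∷ ls)

  toℕ≤n+k : (i : Fin n) → toℕ i ≤ n + k
  toℕ≤n+k i = ≤-trans (<⇒≤ (toℕ<n i)) (m≤m+n n k)

  LMove-< : ∀ {P l} → LMove P l → P < n
  LMove-< (lam-at i refl)  = toℕ<n i
  LMove-< (lamb-at i refl) = toℕ<n i

  LMove-∉Sr : ∀ {P l} → LMove P l → ¬ Alph Sr l
  LMove-∉Sr (lam-at _ _)  ()
  LMove-∉Sr (lamb-at _ _) ()

  LMove-∉Cbstar : ∀ {P l} → LMove P l → ¬ Alph Cbstar l
  LMove-∉Cbstar (lam-at _ _)  ()
  LMove-∉Cbstar (lamb-at _ _) ()

  RMove-∉Sl : ∀ {P r} → RMove P r → ¬ Alph Sl r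
  RMove-∉Sl (theta-at _ _)         ()
  RMove-∉Sl (thetab-at _ _)        ()
  RMove-∉Sl (literal-at _ _ l↦r _) = ↦-∉Sl l↦r
    where
    ↦-∉Sl : ∀ {l a} → l ↦ a → ¬ Alph Sl a
    ↦-∉Sl (pos _) ()
    ↦-∉Sl (neg _) ()
  RMove-∉Sl (b-at _)               ()

  RMove-∉Cstar : ∀ {P r} → RMove P r → ¬ Alph Cstar r
  RMove-∉Cstar (theta-at _ _)         ()
  RMove-∉Cstar (thetab-at _ _)        ()
  RMove-∉Cstar (literal-at _ _ l↦r _) = ↦-∉Cstar l↦r
    where
    ↦-∉Cstar : ∀ {l a} → l ↦ a → ¬ Alph Cstar a
    ↦-∉Cstar (pos _) ()
    ↦-∉Cstar (neg _) ()
  RMove-∉Cstar (b-at _)               ()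

  RMove-≤ : ∀ {P r} → RMove P r → P ≤ n + k
  RMove-≤ (theta-at i refl)       = toℕ≤n+k i
  RMove-≤ (thetab-at i refl)      = toℕ≤n+k i
  RMove-≤ (literal-at c _ _ refl) = +-monoʳ-≤ n (<⇒≤ (toℕ<n c))
  RMove-≤ (b-at refl)             = ≤-refl

  RMove-theta : ∀ {P i} → RMove P (theta i) → toℕ i ≡ P
  RMove-theta (theta-at _ eq) = eq

  RMove-thetab : ∀ {P i} → RMove P (thetab i) → toℕ i ≡ P
  RMove-thetab (thetab-at _ eq) = eq

  RMove-xp-≥ : ∀ {P i} → RMove P (xp i) → n ≤ P
  RMove-xp-≥ (literal-at _ _ _ refl) = m≤m+n n _

  RMove-xn-≥ : ∀ {P i} → RMove P (xn i) → n ≤ P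
  RMove-xn-≥ (literal-at _ _ _ refl) = m≤m+n n _

  RMove-b : ∀ {P} → RMove P b → P ≡ n + k
  RMove-b (b-at eq) = eq

  Matched-left : ∀ {P rs ls} → Matched P rs ls → LWord P ls
  Matched-left (left-only lw)     = lw
  Matched-left (right-only _)     = []
  Matched-left (theta-lamb eq mt) = lamb-at _ eq ∷ Matched-left mt
  Matched-left (thetab-lam eq mt) = lam-at _ eq ∷ Matched-left mt

  Matched-right : ∀ {P rs ls} → Matched P rs ls → RWord P rs
  Matched-right (left-only _)      = []
  Matched-right (right-only rw)    = rw
  Matched-right (theta-lamb eq mt) = theta-at _ eq ∷ Matched-right mt
  Matched-right (thetab-lam eq mt) = thetab-at _ eq ∷ Matched-right mt

  Matched-pair : ∀ {P r l rs ls} → RMove P r → LMove P l → Indep r l → Matched (suc P) rs ls →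
                 Matched P (r ∷ rs) (l ∷ ls)
  Matched-pair (theta-at i refl)  (lam-at _ eq)  ind _  with refl ← toℕ-injective eq =
    ⊥-elim (ind (C i) (C-theta i) (C-lam i))
  Matched-pair (theta-at i refl)  (lamb-at _ eq) _   mt with refl ← toℕ-injective eq = theta-lamb refl mt
  Matched-pair (thetab-at i refl) (lam-at _ eq)  _   mt with refl ← toℕ-injective eq = thetab-lam refl mt
  Matched-pair (thetab-at i refl) (lamb-at _ eq) ind _  with refl ← toℕ-injective eq =
    ⊥-elim (ind (Cb i) (Cb-theta i) (Cb-lam i))
  Matched-pair (literal-at _ _ _ refl) lm _ _ = ⊥-elim (<⇒≱ (LMove-< lm) (m≤m+n n _))
  Matched-pair (b-at refl)             lm _ _ = ⊥-elim (<⇒≱ (LMove-< lm) (m≤m+n n k))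

  Matched-extendʳ : ∀ {P rs ls r} → Matched P rs ls → RMove (P + length rs) r →
                    All (Indep r) (drop (length rs) ls) → Matched P (rs ∷ʳ r) ls
  Matched-extendʳ (left-only [])        rm _         = right-only (reindex-+0 {M = RMove} rm ∷ [])
  Matched-extendʳ (left-only (lm ∷ lw)) rm (ind ∷ _) =
    Matched-pair (reindex-+0 {M = RMove} rm) lm ind (left-only lw)
  Matched-extendʳ (right-only rw)       rm _         = right-only (Along-∷ʳ rw rm)
  Matched-extendʳ (theta-lamb eq mt)    rm ind       =
    theta-lamb eq (Matched-extendʳ mt (reindex-+suc {M = RMove} rm) ind)
  Matched-extendʳ (thetab-lam eq mt)    rm ind       =
    thetab-lam eq (Matched-extendʳ mt (reindex-+suc {M = RMove} rm) ind)

  Matched-extendˡ : ∀ {P rs ls l} → Matched P rs ls → LMove (P + length ls) l → All (Indep l) rs →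
                    Matched P rs (ls ∷ʳ l)
  Matched-extendˡ (left-only lw)         lm _         = left-only (Along-∷ʳ lw lm)
  Matched-extendˡ (right-only [])        lm _         = left-only (reindex-+0 {M = LMove} lm ∷ [])
  Matched-extendˡ (right-only (rm ∷ rw)) lm (ind ∷ _) =
    Matched-pair rm (reindex-+0 {M = LMove} lm) (Indep-sym ind) (right-only rw)
  Matched-extendˡ (theta-lamb eq mt)     lm (_ ∷ ind) =
    theta-lamb eq (Matched-extendˡ mt (reindex-+suc {M = LMove} lm) ind)
  Matched-extendˡ (thetab-lam eq mt)     lm (_ ∷ ind) =
    thetab-lam eq (Matched-extendˡ mt (reindex-+suc {M = LMove} lm) ind)

  ToEnd : TState n k → List (Act n) → Set
  ToEnd t₀ v = Σ Pos λ j → Path (TStep φ) t₀ v (m j) × toℕ j ≡ suc (n + k)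

  pos-after : ∀ P → P ≤ n + k → Σ Pos λ j → toℕ j ≡ suc P
  pos-after P P≤n+k = fromℕ< (s≤s (s≤s P≤n+k)) , toℕ-fromℕ< (s≤s (s≤s P≤n+k))

  T-move : ∀ {j a t′} → TStep φ (m j) a t′ → RMove (toℕ j) a
  T-move (T-theta i eq)      = theta-at i (sym eq)
  T-move (T-thetab i eq)     = thetab-at i (sym eq)
  T-move (T-clause c q eq _) = literal-at c q (↦-litAct (φ c q)) (sym eq)
  T-move (T-b eq _)          = b-at eq

  end-dead : ∀ {j a t′} → toℕ j ≡ suc (n + k) → ¬ TStep φ (m j) a t′
  end-dead j≡ tstep = 1+n≰n (subst (_≤ n + k) j≡ (RMove-≤ (T-move tstep)))

  T-step-right : ∀ {P r j j′} → RMove P r → n ≤ P → toℕ j ≡ P → toℕ j′ ≡ suc P → TStep φ (m j) r (m j′)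
  T-step-right (theta-at i refl)       n≤P _  _   = ⊥-elim (<⇒≱ (toℕ<n i) n≤P)
  T-step-right (thetab-at i refl)      n≤P _  _   = ⊥-elim (<⇒≱ (toℕ<n i) n≤P)
  T-step-right (literal-at c q x refl) _   j≡ j′≡ =
    subst (λ a → TStep φ _ a _) (↦⇒litAct x) (T-clause c q j≡ j′≡)
  T-step-right (b-at refl)             _   j≡ j′≡ = T-b j≡ j′≡

  T-run-right : ∀ {P rs} → RWord P rs → n ≤ P → P + length rs ≡ suc (n + k) →
                (j : Pos) → toℕ j ≡ P → ToEnd (m j) rs
  T-run-right {P} [] _ len j j≡ = j , done , trans j≡ (trans (sym (+-identityʳ P)) len)
  T-run-right {P} {_ ∷ rs} (rm ∷ rw) n≤P len j j≡
    with j′ , j′≡ ← pos-after P (RMove-≤ rm)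
    with end , path , end≡ ← T-run-right rw (m≤n⇒m≤1+n n≤P) (trans (sym (+-suc P (length rs))) len) j′ j′≡
    = end , step (T-step-right rm n≤P j≡ j′≡) path , end≡

  +suc≡n⇒≤n+k : ∀ {P L} → P + suc L ≡ n → P ≤ n + k
  +suc≡n⇒≤n+k {P} len = ≤-trans (<⇒≤ (subst (P <_) len (m<m+n P z<s))) (m≤m+n n k)

  T-run : ∀ {P rs ls} → Matched P rs ls → P + length ls ≡ n → P + length rs ≡ suc (n + k) →
          (j : Pos) → toℕ j ≡ P → ToEnd (m j) (alternate rs ls)
  T-run {P} {ls = ls} (left-only _) lenˡ lenʳ _ _ =
    ⊥-elim (<⇒≱ (s≤s (m≤m+n n k))
                (subst (_≤ n) (trans (sym (+-identityʳ P)) lenʳ) (subst (P ≤_) lenˡ (m≤m+n P (length ls)))))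
  T-run {P} {rs} (right-only rw) lenˡ lenʳ j j≡ rewrite alternate-[]ʳ rs =
    T-run-right rw (≤-reflexive (trans (sym lenˡ) (+-identityʳ P))) lenʳ j j≡
  T-run {P} {_ ∷ rs} {_ ∷ ls} (theta-lamb {i = i} eq mt) lenˡ lenʳ j j≡
    with j′ , j′≡ ← pos-after P (+suc≡n⇒≤n+k lenˡ)
    with end , path , end≡ ← T-run mt (trans (sym (+-suc P (length ls))) lenˡ)
                                      (trans (sym (+-suc P (length rs))) lenʳ) j′ j′≡
    = end , step (T-theta i (trans j≡ (sym eq))) (step (T-lamb i (trans j′≡ (cong suc (sym eq)))) path) , end≡
  T-run {P} {_ ∷ rs} {_ ∷ ls} (thetab-lam {i = i} eq mt) lenˡ lenʳ j j≡
    with j′ , j′≡ ← pos-after P (+suc≡n⇒≤n+k lenˡ)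
    with end , path , end≡ ← T-run mt (trans (sym (+-suc P (length ls))) lenˡ)
                                      (trans (sym (+-suc P (length rs))) lenʳ) j′ j′≡
    = end , step (T-thetab i (trans j≡ (sym eq))) (step (T-lam i (trans j′≡ (cong suc (sym eq)))) path) , end≡

  clause-index : ∀ {P} → n ≤ P → P < n + k → Σ (Fin k) λ c → n + toℕ c ≡ P
  clause-index {P} n≤P P<n+k = fromℕ< c< , trans (cong (n +_) (toℕ-fromℕ< c<)) (m+[n∸m]≡n n≤P)
    where
    c< : P ∸ n < k
    c< = subst (P ∸ n <_) (m+n∸m≡n n k) (∸-monoˡ-< P<n+k n≤P)

  T-stuck : ∀ {t₀} → (∀ a t′ → ¬ TStep φ t₀ a t′) → Σ Pos λ j → t₀ ≡ m j × toℕ j ≡ suc (n + k)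
  T-stuck {p0}  dead = ⊥-elim (dead _ _ (T-e {j = fz} refl))
  T-stuck {t i} dead = ⊥-elim (dead _ _ (T-lamb i (proj₂ (pos-after (toℕ i) (toℕ≤n+k i)))))
  T-stuck {f i} dead = ⊥-elim (dead _ _ (T-lam i (proj₂ (pos-after (toℕ i) (toℕ≤n+k i)))))
  T-stuck {m j} dead = j , refl , ≤-antisym (≤-pred (toℕ<n j)) (≤∧≢⇒< past-clauses λ j≡ →
                         dead _ _ (T-b (sym j≡) (proj₂ (pos-after (n + k) ≤-refl))))
    where
    past-variables : n ≤ toℕ j
    past-variables = ≮⇒≥ λ j<n → dead _ _ (T-theta (fromℕ< j<n) (sym (toℕ-fromℕ< j<n)))
    past-clauses : n + k ≤ toℕ j
    past-clauses = ≮⇒≥ λ j<n+k → let c , c≡ = clause-index past-variables j<n+k in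
      dead _ _ (T-clause c fz (sym c≡) (proj₂ (pos-after (n + toℕ c) (+-monoʳ-≤ n (<⇒≤ (toℕ<n c))))))

  CStep-to-bottom : ∀ {th lm x : Act n} {y a z} → CStep th lm x y a z → z ≡ bottom
  CStep-to-bottom c-th = refl
  CStep-to-bottom c-lm = refl
  CStep-to-bottom c-x  = refl

  CStep-from-top : ∀ {th lm x : Act n} {y a z} → CStep th lm x y a z → a ≢ x → y ≡ top
  CStep-from-top c-th _   = refl
  CStep-from-top c-lm _   = refl
  CStep-from-top c-x  a≢x = ⊥-elim (a≢x refl)

  CStep-loop : ∀ {th lm x : Act n} {y z} → th ≢ x → lm ≢ x → CStep th lm x y x z → y ≡ bottom
  CStep-loop th≢x _    c-th = ⊥-elim (th≢x refl)
  CStep-loop _    lm≢x c-lm = ⊥-elim (lm≢x refl)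
  CStep-loop _    _    c-x  = refl

  SlStep-advances : ∀ {j a j′} → SlStep {n} j a j′ → toℕ j′ ≡ suc (toℕ j)
  SlStep-advances (sl-e p q)      = trans q (cong suc (sym p))
  SlStep-advances (sl-eb p q)     = trans q (cong suc (sym p))
  SlStep-advances (sl-lam _ p q)  = trans q (cong suc (sym p))
  SlStep-advances (sl-lamb _ p q) = trans q (cong suc (sym p))

  SlStep-e : ∀ {j j′} → SlStep {n} j e j′ → toℕ j ≡ 0
  SlStep-e (sl-e p _) = p

  SlStep-eb : ∀ {j j′} → SlStep {n} j eb j′ → toℕ j ≡ 0
  SlStep-eb (sl-eb p _) = p

  SlStep-lam : ∀ {i j j′} → SlStep {n} j (lam i) j′ → toℕ j ≡ suc (toℕ i)
  SlStep-lam (sl-lam _ p _) = p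

  SlStep-lamb : ∀ {i j j′} → SlStep {n} j (lamb i) j′ → toℕ j ≡ suc (toℕ i)
  SlStep-lamb (sl-lamb _ p _) = p

  SrStep-advances : ∀ {j a j′} → SrStep φ j a j′ → toℕ j′ ≡ suc (toℕ j)
  SrStep-advances (sr-theta _ p q)    = trans q (cong suc (sym p))
  SrStep-advances (sr-thetab _ p q)   = trans q (cong suc (sym p))
  SrStep-advances (sr-clause _ _ p q) = trans q (cong suc (sym p))
  SrStep-advances (sr-b p q)          = trans q (cong suc (sym p))

  SrStep-move : ∀ {j a j′} → SrStep φ j a j′ → RMove (toℕ j) a
  SrStep-move (sr-theta i p _)    = theta-at i (sym p)
  SrStep-move (sr-thetab i p _)   = thetab-at i (sym p)
  SrStep-move (sr-clause c q p _) = literal-at c q (↦-litAct (φ c q)) (sym p)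
  SrStep-move (sr-b p _)          = b-at p

  module _ {s s′ : Global} {a : Act n} (g : GStep φ s a s′) where

    unmoved : ∀ p → ¬ Alph p a → s′ p ≡ s p
    unmoved p a∉p = proj₂ (g p) a∉p

    C-bottom : ∀ i → Alph (C i) a → s′ (C i) ≡ bottom
    C-bottom i a∈C = CStep-to-bottom (proj₁ (g (C i)) a∈C)

    Cb-bottom : ∀ i → Alph (Cb i) a → s′ (Cb i) ≡ bottom
    Cb-bottom i a∈Cb = CStep-to-bottom (proj₁ (g (Cb i)) a∈Cb)

    C-stays-bottom : ∀ i → s (C i) ≡ bottom → s′ (C i) ≡ bottom
    C-stays-bottom i eq with alph? (C i) a
    ... | yes a∈C = C-bottom i a∈C
    ... | no  a∉C = trans (unmoved (C i) a∉C) eq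

    Cb-stays-bottom : ∀ i → s (Cb i) ≡ bottom → s′ (Cb i) ≡ bottom
    Cb-stays-bottom i eq with alph? (Cb i) a
    ... | yes a∈Cb = Cb-bottom i a∈Cb
    ... | no  a∉Cb = trans (unmoved (Cb i) a∉Cb) eq

    Settled-mono : ∀ {c} → Settled s c → Settled s′ c
    Settled-mono set = record
      { C-settled  = λ i c∈C  → C-stays-bottom i (C-settled set i c∈C)
      ; Cb-settled = λ i c∈Cb → Cb-stays-bottom i (Cb-settled set i c∈Cb) }

    All-Settled-∷ʳ : ∀ {xs} → All (Settled s) xs → All (Settled s′) (xs ∷ʳ a)
    All-Settled-∷ʳ set =
      ++⁺ (All.map Settled-mono set) (record { C-settled = C-bottom ; Cb-settled = Cb-bottom } ∷ [])

    bottoms-unmoved : ∀ i → ¬ Alph (C i) a → ¬ Alph (Cb i) a → bottoms s′ i ≡ bottoms s i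
    bottoms-unmoved i a∉C a∉Cb = cong₂ (λ x y → isBot x + isBot y) (unmoved (C i) a∉C) (unmoved (Cb i) a∉Cb)

    bottoms-C-drops : ∀ i → Alph (C i) a → s (C i) ≡ top → ¬ Alph (Cb i) a →
                      bottoms s′ i ≡ suc (bottoms s i)
    bottoms-C-drops i a∈C C-top a∉Cb rewrite C-bottom i a∈C | C-top | unmoved (Cb i) a∉Cb = refl

    bottoms-Cb-drops : ∀ i → Alph (Cb i) a → s (Cb i) ≡ top → ¬ Alph (C i) a →
                       bottoms s′ i ≡ suc (bottoms s i)
    bottoms-Cb-drops i a∈Cb Cb-top a∉C rewrite Cb-bottom i a∈Cb | Cb-top | unmoved (C i) a∉C =
      +-suc (isBot (s (C i))) 0

  theta-indep-left : ∀ {s i P l} → s (C i) ≡ top → LMove P l → Settled s l → Indep (theta i) l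
  theta-indep-left C-top _  set (C _) (C-theta _)  l∈C  = top≢bottom C-top (C-settled set _ l∈C)
  theta-indep-left _     lm _   Sr    (Sr-theta _) l∈Sr = LMove-∉Sr lm l∈Sr

  thetab-indep-left : ∀ {s i P l} → s (Cb i) ≡ top → LMove P l → Settled s l → Indep (thetab i) l
  thetab-indep-left Cb-top _  set (Cb _) (Cb-theta _)  l∈Cb = top≢bottom Cb-top (Cb-settled set _ l∈Cb)
  thetab-indep-left _      lm _   Sr     (Sr-thetab _) l∈Sr = LMove-∉Sr lm l∈Sr

  lam-indep-right : ∀ {s i P r} → s (C i) ≡ top → RMove P r → Settled s r → Indep (lam i) r
  lam-indep-right C-top _  set (C _) (C-lam _)  r∈C  = top≢bottom C-top (C-settled set _ r∈C)
  lam-indep-right _     rm _   Sl    (Sl-lam _) r∈Sl = RMove-∉Sl rm r∈Sl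

  lamb-indep-right : ∀ {s i P r} → s (Cb i) ≡ top → RMove P r → Settled s r → Indep (lamb i) r
  lamb-indep-right Cb-top _  set (Cb _) (Cb-lam _)  r∈Cb = top≢bottom Cb-top (Cb-settled set _ r∈Cb)
  lamb-indep-right _      rm _   Sl     (Sl-lamb _) r∈Sl = RMove-∉Sl rm r∈Sl

  e-indep-right : ∀ {P r} → RMove P r → Indep e r
  e-indep-right rm Cstar Cstar-e r∈C* = RMove-∉Cstar rm r∈C*
  e-indep-right rm Sl    Sl-e    r∈Sl = RMove-∉Sl rm r∈Sl

  record Sides : Set where
    constructor sides
    field
      started : Bool
      left    : List (Act n)
      right   : List (Act n)

  Sl-position : Bool → List (Act n) → ℕ
  Sl-position false _  = 0
  Sl-position true  ls = suc (length ls)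

  record Inv (s : Global) (A : Sides) : Set where
    open Sides A
    field
      unstarted-left        : started ≡ false → left ≡ []
      at-Sl                 : toℕ (s Sl) ≡ Sl-position started left
      at-Sr                 : toℕ (s Sr) ≡ length right
      Cstar-idle            : started ≡ false → s Cstar ≡ c0
      Cbstar-idle-unstarted : started ≡ false → s Cbstar ≡ d0
      Cbstar-idle           : length right ≤ n + k → s Cbstar ≡ d0
      matched               : Matched 0 right left
      settledˡ              : All (Settled s) left
      settledʳ              : All (Settled s) right
      bottoms-passed        : ∀ i → bottoms s i ≡ passed (toℕ i) (length right) + passed (toℕ i) (length left)

  linearise : Sides → List (Act n)
  linearise (sides false _  rs) = rs
  linearise (sides true  ls rs) = e ∷ alternate rs ls

  -- ē never fires in a state satisfying the invariant (eb-blocked), so its clause is arbitrary.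
  extend : Sides → Act n → Sides
  extend (sides _  _  rs) e        = sides true [] rs
  extend A                eb       = A
  extend (sides le ls rs) (lam i)  = sides le (ls ∷ʳ lam i) rs
  extend (sides le ls rs) (lamb i) = sides le (ls ∷ʳ lamb i) rs
  extend (sides le ls rs) a        = sides le ls (rs ∷ʳ a)

  extend-literal : ∀ {le ls rs} l → extend (sides le ls rs) (litAct l) ≡ sides le ls (rs ∷ʳ litAct l)
  extend-literal (pos _) = refl
  extend-literal (neg _) = refl

  Continues : Global → Sides → Act n → Sides → Set
  Continues s′ A a A′ = Inv s′ A′ × (linearise A′ ∼ (linearise A ∷ʳ a))

  Preserved : Global → Sides → Act n → Set
  Preserved s′ A a = Continues s′ A a (extend A a)

  module _ {s : Global} {le : Bool} {ls rs : List (Act n)} (inv : Inv s (sides le ls rs)) where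
    open Inv inv

    left-≤n : length ls ≤ n
    left-≤n = Along-length LMove-< (Matched-left matched) z≤n

    right-move : ∀ {s′ r} → GStep φ s r s′ → Alph Sr r → RMove (length rs) r
    right-move g r∈Sr = subst (λ P → RMove P _) at-Sr (SrStep-move (proj₁ (g Sr) r∈Sr))

    one-top : ∀ i → length rs ≤ toℕ i ⊎ length ls ≤ toℕ i → s (C i) ≡ top ⊎ s (Cb i) ≡ top
    one-top i lagging = isBot-sum≤1 _ _ (subst (_≤ 1) (sym (bottoms-passed i)) (sum≤1 lagging))
      where
      sum≤1 : length rs ≤ toℕ i ⊎ length ls ≤ toℕ i →
              passed (toℕ i) (length rs) + passed (toℕ i) (length ls) ≤ 1
      sum≤1 (inj₁ rs≤) rewrite passed-≥ rs≤ = passed≤1 (toℕ i) (length ls)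
      sum≤1 (inj₂ ls≤) rewrite passed-≥ ls≤ | +-identityʳ (passed (toℕ i) (length rs)) =
        passed≤1 (toℕ i) (length rs)

    both-top : ∀ i → length rs ≤ toℕ i → length ls ≤ toℕ i → s (C i) ≡ top × s (Cb i) ≡ top
    both-top i rs≤ ls≤ = isBot-sum≡0 _ _ (trans (bottoms-passed i) (cong₂ _+_ (passed-≥ rs≤) (passed-≥ ls≤)))

    both-bottom : ∀ i → toℕ i < length rs → toℕ i < length ls → s (C i) ≡ bottom × s (Cb i) ≡ bottom
    both-bottom i <rs <ls =
      isBot-sum≡2 _ _ (trans (bottoms-passed i) (cong₂ _+_ (passed-< <rs) (passed-< <ls)))

    step-right : ∀ {s′ r} → GStep φ s r s′ → Alph Sr r → All (Indep r) (drop (length rs) ls) →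
                 (∀ j → toℕ j ≡ length rs → bottoms s′ j ≡ suc (bottoms s j)) →
                 (∀ j → toℕ j ≢ length rs → bottoms s′ j ≡ bottoms s j) →
                 ¬ Alph Cbstar r ⊎ (length rs ≡ n + k × le ≢ false) →
                 Continues s′ (sides le ls rs) r (sides le ls (rs ∷ʳ r))
    step-right {s′} {r} g r∈Sr ind grow same Cbstar-ok = inv′ , linearise-∼ le
      where
      rm : RMove (length rs) r
      rm = right-move g r∈Sr
      Cbstar-stays : ¬ Alph Cbstar r → s′ Cbstar ≡ s Cbstar
      Cbstar-stays = unmoved g Cbstar
      rs′≤ : length (rs ∷ʳ r) ≤ n + k → length rs ≤ n + k
      rs′≤ len≤ = ≤-trans (n≤1+n _) (subst (_≤ n + k) (length-∷ʳ rs r) len≤)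
      inv′ : Inv s′ (sides le ls (rs ∷ʳ r))
      inv′ = record
        { unstarted-left        = unstarted-left
        ; at-Sl                 = trans (cong toℕ (unmoved g Sl (RMove-∉Sl rm))) at-Sl
        ; at-Sr                 = trans (SrStep-advances (proj₁ (g Sr) r∈Sr))
                                        (trans (cong suc at-Sr) (sym (length-∷ʳ rs r)))
        ; Cstar-idle            = λ le≡ → trans (unmoved g Cstar (RMove-∉Cstar rm)) (Cstar-idle le≡)
        ; Cbstar-idle-unstarted = λ le≡ → case Cbstar-ok of λ
            { (inj₁ r∉C̄*)       → trans (Cbstar-stays r∉C̄*) (Cbstar-idle-unstarted le≡)
            ; (inj₂ (_ , le≢f)) → ⊥-elim (le≢f le≡) }
        ; Cbstar-idle           = λ len≤ → case Cbstar-ok of λ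
            { (inj₁ r∉C̄*)      → trans (Cbstar-stays r∉C̄*) (Cbstar-idle (rs′≤ len≤))
            ; (inj₂ (len≡ , _)) →
                ⊥-elim (1+n≰n (subst (_≤ n + k) (trans (length-∷ʳ rs r) (cong suc len≡)) len≤)) }
        ; matched               = Matched-extendʳ matched rm ind
        ; settledˡ              = All.map (Settled-mono g) settledˡ
        ; settledʳ              = All-Settled-∷ʳ g settledʳ
        ; bottoms-passed        = λ j →
            subst (λ L → bottoms s′ j ≡ passed (toℕ j) L + passed (toℕ j) (length ls)) (sym (length-∷ʳ rs r))
                  (passed-tickˡ (toℕ j) (length rs) (grow j) (same j) (bottoms-passed j))
        }
      linearise-∼ : ∀ le′ → linearise (sides le′ ls (rs ∷ʳ r)) ∼ (linearise (sides le′ ls rs) ∷ʳ r)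
      linearise-∼ false = ε
      linearise-∼ true  = ∼-∷ e (alternate-∷ʳ₁ r rs ls ind)

    step-theta : ∀ {s′} i → GStep φ s (theta i) s′ → Preserved s′ (sides le ls rs) (theta i)
    step-theta {s′} i g = step-right g (Sr-theta i) ind grow same (inj₁ λ ())
      where
      i≡ : toℕ i ≡ length rs
      i≡ = RMove-theta (right-move g (Sr-theta i))
      C-top : s (C i) ≡ top
      C-top = CStep-from-top (proj₁ (g (C i)) (C-theta i)) λ ()
      ind : All (Indep (theta i)) (drop (length rs) ls)
      ind = drop⁺ (length rs) (Along-All (theta-indep-left C-top) (Matched-left matched) settledˡ)
      grow : ∀ j → toℕ j ≡ length rs → bottoms s′ j ≡ suc (bottoms s j)
      grow j j≡ with refl ← toℕ-injective (trans j≡ (sym i≡)) = bottoms-C-drops g i (C-theta i) C-top λ ()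
      same : ∀ j → toℕ j ≢ length rs → bottoms s′ j ≡ bottoms s j
      same j j≢ = bottoms-unmoved g j (λ { (C-theta _) → j≢ i≡ }) λ ()

    step-thetab : ∀ {s′} i → GStep φ s (thetab i) s′ → Preserved s′ (sides le ls rs) (thetab i)
    step-thetab {s′} i g = step-right g (Sr-thetab i) ind grow same (inj₁ λ ())
      where
      i≡ : toℕ i ≡ length rs
      i≡ = RMove-thetab (right-move g (Sr-thetab i))
      Cb-top : s (Cb i) ≡ top
      Cb-top = CStep-from-top (proj₁ (g (Cb i)) (Cb-theta i)) λ ()
      ind : All (Indep (thetab i)) (drop (length rs) ls)
      ind = drop⁺ (length rs) (Along-All (thetab-indep-left Cb-top) (Matched-left matched) settledˡ)
      grow : ∀ j → toℕ j ≡ length rs → bottoms s′ j ≡ suc (bottoms s j)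
      grow j j≡ with refl ← toℕ-injective (trans j≡ (sym i≡)) = bottoms-Cb-drops g i (Cb-theta i) Cb-top λ ()
      same : ∀ j → toℕ j ≢ length rs → bottoms s′ j ≡ bottoms s j
      same j j≢ = bottoms-unmoved g j (λ ()) λ { (Cb-theta _) → j≢ i≡ }

    nothing-left-after : ∀ {r} → n ≤ length rs → All (Indep r) (drop (length rs) ls)
    nothing-left-after n≤ = subst (All _) (sym (drop-all (length rs) ls (≤-trans left-≤n n≤))) []

    no-variable-at : ∀ {s′} → n ≤ length rs → ∀ j → toℕ j ≡ length rs → bottoms s′ j ≡ suc (bottoms s j)
    no-variable-at n≤ j j≡ = ⊥-elim (toℕ≢≥ j n≤ j≡)

    step-xp : ∀ {s′} i → GStep φ s (xp i) s′ → Preserved s′ (sides le ls rs) (xp i)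
    step-xp {s′} i g =
      step-right g (Sr-xp i) (nothing-left-after n≤) (no-variable-at {s′} n≤) same (inj₁ λ ())
      where
      n≤ : n ≤ length rs
      n≤ = RMove-xp-≥ (right-move g (Sr-xp i))
      C-same : ∀ j → s′ (C j) ≡ s (C j)
      C-same j with j ≟ᶠ i
      ... | yes refl =
        trans (C-bottom g i (C-x i)) (sym (CStep-loop (λ ()) (λ ()) (proj₁ (g (C i)) (C-x i))))
      ... | no  j≢i  = unmoved g (C j) λ { (C-x _) → j≢i refl }
      same : ∀ j → toℕ j ≢ length rs → bottoms s′ j ≡ bottoms s j
      same j _ = cong₂ (λ x y → isBot x + isBot y) (C-same j) (unmoved g (Cb j) λ ())

    step-xn : ∀ {s′} i → GStep φ s (xn i) s′ → Preserved s′ (sides le ls rs) (xn i)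
    step-xn {s′} i g =
      step-right g (Sr-xn i) (nothing-left-after n≤) (no-variable-at {s′} n≤) same (inj₁ λ ())
      where
      n≤ : n ≤ length rs
      n≤ = RMove-xn-≥ (right-move g (Sr-xn i))
      Cb-same : ∀ j → s′ (Cb j) ≡ s (Cb j)
      Cb-same j with j ≟ᶠ i
      ... | yes refl =
        trans (Cb-bottom g i (Cb-x i)) (sym (CStep-loop (λ ()) (λ ()) (proj₁ (g (Cb i)) (Cb-x i))))
      ... | no  j≢i  = unmoved g (Cb j) λ { (Cb-x _) → j≢i refl }
      same : ∀ j → toℕ j ≢ length rs → bottoms s′ j ≡ bottoms s j
      same j _ = cong₂ (λ x y → isBot x + isBot y) (unmoved g (C j) λ ()) (Cb-same j)

    step-b : ∀ {s′} → le ≢ false → GStep φ s b s′ → Preserved s′ (sides le ls rs) b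
    step-b {s′} started g = step-right g Sr-b (nothing-left-after n≤) (no-variable-at {s′} n≤)
                                  (λ j _ → bottoms-unmoved g j (λ ()) (λ ())) (inj₂ (len , started))
      where
      len : length rs ≡ n + k
      len = RMove-b (right-move g Sr-b)
      n≤ : n ≤ length rs
      n≤ = subst (n ≤_) (sym len) (m≤m+n n k)

  module _ {s : Global} {ls rs : List (Act n)} (inv : Inv s (sides true ls rs)) where
    open Inv inv

    e-blocked : ∀ {s′} → ¬ GStep φ s e s′
    e-blocked g = 0≢1+n (trans (sym (SlStep-e (proj₁ (g Sl) Sl-e))) at-Sl)

    eb-blocked : ∀ {s′} → ¬ GStep φ s eb s′
    eb-blocked g = 0≢1+n (trans (sym (SlStep-eb (proj₁ (g Sl) Sl-eb))) at-Sl)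

    lam-position : ∀ {s′ i} → GStep φ s (lam i) s′ → toℕ i ≡ length ls
    lam-position {i = i} g = sym (suc-injective (trans (sym at-Sl) (SlStep-lam (proj₁ (g Sl) (Sl-lam i)))))

    lamb-position : ∀ {s′ i} → GStep φ s (lamb i) s′ → toℕ i ≡ length ls
    lamb-position {i = i} g = sym (suc-injective (trans (sym at-Sl) (SlStep-lamb (proj₁ (g Sl) (Sl-lamb i)))))

    left-move : ∀ {s′ l} → GStep φ s l s′ → Alph Sl l → LMove (length ls) l
    left-move g Sl-e        = ⊥-elim (e-blocked g)
    left-move g Sl-eb       = ⊥-elim (eb-blocked g)
    left-move g (Sl-lam i)  = lam-at i (lam-position g)
    left-move g (Sl-lamb i) = lamb-at i (lamb-position g)

    final-dead : length ls ≡ n → length rs ≡ suc (n + k) → ∀ a s′ → ¬ GStep φ s a s′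
    final-dead ls≡ rs≡ a _ g with Sl-or-Sr a
    ... | inj₁ a∈Sl = <-irrefl ls≡ (LMove-< (left-move g a∈Sl))
    ... | inj₂ a∈Sr = 1+n≰n (subst (_≤ n + k) rs≡ (RMove-≤ (right-move inv g a∈Sr)))

    step-left : ∀ {s′ l} → GStep φ s l s′ → Alph Sl l → All (Indep l) rs →
                (∀ j → toℕ j ≡ length ls → bottoms s′ j ≡ suc (bottoms s j)) →
                (∀ j → toℕ j ≢ length ls → bottoms s′ j ≡ bottoms s j) →
                Continues s′ (sides true ls rs) l (sides true (ls ∷ʳ l) rs)
    step-left {s′} {l} g l∈Sl ind grow same =
      inv′ , ∼-∷ e (alternate-∷ʳ₂ l rs ls (drop⁺ (suc (length ls)) ind))
      where
      lm : LMove (length ls) l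
      lm = left-move g l∈Sl
      inv′ : Inv s′ (sides true (ls ∷ʳ l) rs)
      inv′ = record
        { unstarted-left        = λ ()
        ; at-Sl                 = trans (SlStep-advances (proj₁ (g Sl) l∈Sl))
                                        (cong suc (trans at-Sl (sym (length-∷ʳ ls l))))
        ; at-Sr                 = trans (cong toℕ (unmoved g Sr (LMove-∉Sr lm))) at-Sr
        ; Cstar-idle            = λ ()
        ; Cbstar-idle-unstarted = λ ()
        ; Cbstar-idle           = λ len≤ → trans (unmoved g Cbstar (LMove-∉Cbstar lm)) (Cbstar-idle len≤)
        ; matched               = Matched-extendˡ matched lm ind
        ; settledˡ              = All-Settled-∷ʳ g settledˡ
        ; settledʳ              = All.map (Settled-mono g) settledʳ
        ; bottoms-passed        = λ j →
            subst (λ L → bottoms s′ j ≡ passed (toℕ j) (length rs) + passed (toℕ j) L) (sym (length-∷ʳ ls l))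
                  (passed-tickʳ (toℕ j) (length ls) (grow j) (same j) (bottoms-passed j))
        }

    step-lam : ∀ {s′} i → GStep φ s (lam i) s′ → Preserved s′ (sides true ls rs) (lam i)
    step-lam {s′} i g = step-left g (Sl-lam i) ind grow same
      where
      i≡ : toℕ i ≡ length ls
      i≡ = lam-position g
      C-top : s (C i) ≡ top
      C-top = CStep-from-top (proj₁ (g (C i)) (C-lam i)) λ ()
      ind : All (Indep (lam i)) rs
      ind = Along-All (lam-indep-right C-top) (Matched-right matched) settledʳ
      grow : ∀ j → toℕ j ≡ length ls → bottoms s′ j ≡ suc (bottoms s j)
      grow j j≡ with refl ← toℕ-injective (trans j≡ (sym i≡)) = bottoms-C-drops g i (C-lam i) C-top λ ()
      same : ∀ j → toℕ j ≢ length ls → bottoms s′ j ≡ bottoms s j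
      same j j≢ = bottoms-unmoved g j (λ { (C-lam _) → j≢ i≡ }) λ ()

    step-lamb : ∀ {s′} i → GStep φ s (lamb i) s′ → Preserved s′ (sides true ls rs) (lamb i)
    step-lamb {s′} i g = step-left g (Sl-lamb i) ind grow same
      where
      i≡ : toℕ i ≡ length ls
      i≡ = lamb-position g
      Cb-top : s (Cb i) ≡ top
      Cb-top = CStep-from-top (proj₁ (g (Cb i)) (Cb-lam i)) λ ()
      ind : All (Indep (lamb i)) rs
      ind = Along-All (lamb-indep-right Cb-top) (Matched-right matched) settledʳ
      grow : ∀ j → toℕ j ≡ length ls → bottoms s′ j ≡ suc (bottoms s j)
      grow j j≡ with refl ← toℕ-injective (trans j≡ (sym i≡)) = bottoms-Cb-drops g i (Cb-lam i) Cb-top λ ()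
      same : ∀ j → toℕ j ≢ length ls → bottoms s′ j ≡ bottoms s j
      same j j≢ = bottoms-unmoved g j (λ ()) λ { (Cb-lam _) → j≢ i≡ }

  module _ {s : Global} {ls rs : List (Act n)} (inv : Inv s (sides false ls rs)) where
    open Inv inv

    no-left : ls ≡ []
    no-left = unstarted-left refl

    lam-blocked : ∀ {s′} i → ¬ GStep φ s (lam i) s′
    lam-blocked i g = 0≢1+n (trans (sym at-Sl) (SlStep-lam (proj₁ (g Sl) (Sl-lam i))))

    lamb-blocked : ∀ {s′} i → ¬ GStep φ s (lamb i) s′
    lamb-blocked i g = 0≢1+n (trans (sym at-Sl) (SlStep-lamb (proj₁ (g Sl) (Sl-lamb i))))

    eb-blocked-unstarted : ∀ {s′} → ¬ GStep φ s eb s′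
    eb-blocked-unstarted {s′} g =
      no-eb-from-d0 (subst (λ y → CbsStep y eb (s′ Cbstar)) (Cbstar-idle-unstarted refl)
                           (proj₁ (g Cbstar) Cbstar-eb))
      where
      no-eb-from-d0 : ∀ {z} → ¬ CbsStep {n} d0 eb z
      no-eb-from-d0 ()

    step-e : ∀ {s′} → GStep φ s e s′ → Preserved s′ (sides false ls rs) e
    step-e {s′} g = inv′ , linearise-∼
      where
      inv′ : Inv s′ (sides true [] rs)
      inv′ = record
        { unstarted-left        = λ ()
        ; at-Sl                 = trans (SlStep-advances (proj₁ (g Sl) Sl-e))
                                        (cong suc (SlStep-e (proj₁ (g Sl) Sl-e)))
        ; at-Sr                 = trans (cong toℕ (unmoved g Sr λ ())) at-Sr
        ; Cstar-idle            = λ ()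
        ; Cbstar-idle-unstarted = λ ()
        ; Cbstar-idle           = λ len≤ → trans (unmoved g Cbstar λ ()) (Cbstar-idle len≤)
        ; matched               = right-only (Matched-right matched)
        ; settledˡ              = []
        ; settledʳ              = All.map (Settled-mono g) settledʳ
        ; bottoms-passed        = λ j →
            trans (bottoms-unmoved g j (λ ()) (λ ()))
                  (trans (bottoms-passed j) (cong (λ xs → _ + passed (toℕ j) (length xs)) no-left))
        }
      linearise-∼ : (e ∷ alternate rs []) ∼ (rs ∷ʳ e)
      linearise-∼ rewrite alternate-[]ʳ rs =
        ∼-commute-to-end e rs (Along-All (λ rm _ → e-indep-right rm) (Matched-right matched) settledʳ)

    -- Before e only S_r has moved, so C_i is at bottom exactly when S_r chose θ_i.
    assignment : Fin n → Bool
    assignment i = isBottom (s (C i))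

    literal-true : ∀ l → Settled s (litAct l) → evalLit assignment l ≡ true
    literal-true (pos i) set rewrite C-settled set i (C-x i) = refl
    literal-true (neg i) set with one-top inv i (inj₂ (subst (λ xs → length xs ≤ toℕ i) (sym no-left) z≤n))
    ... | inj₁ C-top  rewrite C-top = refl
    ... | inj₂ Cb-top = ⊥-elim (top≢bottom Cb-top (Cb-settled set i (Cb-x i)))

    clause-settled : n + k ≤ length rs → (c : Fin k) → Σ (Fin 3) λ q → Settled s (litAct (φ c q))
    clause-settled len c
      with a , rm , a∈ ← Along-at (Matched-right matched) z≤n (≤-trans (+-monoʳ-< n (toℕ<n c)) len)
      = from-move rm (All.lookup settledʳ a∈)
      where
      from-move : ∀ {a} → RMove (n + toℕ c) a → Settled s a → Σ (Fin 3) λ q → Settled s (litAct (φ c q))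
      from-move (theta-at i eq)        _   = ⊥-elim (toℕ≢≥ i (m≤m+n n _) eq)
      from-move (thetab-at i eq)       _   = ⊥-elim (toℕ≢≥ i (m≤m+n n _) eq)
      from-move (literal-at _ q x eq)  set with refl ← toℕ-injective (+-cancelˡ-≡ n _ _ eq) =
        q , subst (Settled s) (sym (↦⇒litAct x)) set
      from-move (b-at eq)              _   = ⊥-elim (toℕ≢≥ c ≤-refl (+-cancelˡ-≡ n _ _ eq))

    satisfying-assignment : n + k ≤ length rs → Satisfiable φ
    satisfying-assignment len = assignment , λ c →
      let q , set = clause-settled len c in q , literal-true (φ c q) set

  Inv-init : Inv (GInit n k) (sides false [] [])
  Inv-init = record
    { unstarted-left        = λ _ → refl
    ; at-Sl                 = refl
    ; at-Sr                 = refl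
    ; Cstar-idle            = λ _ → refl
    ; Cbstar-idle-unstarted = λ _ → refl
    ; Cbstar-idle           = λ _ → refl
    ; matched               = left-only []
    ; settledˡ              = []
    ; settledʳ              = []
    ; bottoms-passed        = λ _ → refl
    }

  module _ {s : Global} where

    Sl-next : ∀ {P} → toℕ (s Sl) ≡ P → P < suc n → toℕ (advance Sl (s Sl)) ≡ suc P
    Sl-next Sl≡ P< = trans (toℕ-next (s Sl) (subst (_< suc n) (sym Sl≡) P<)) (cong suc Sl≡)

    Sr-next : ∀ {P} → toℕ (s Sr) ≡ P → P < suc (n + k) → toℕ (advance Sr (s Sr)) ≡ suc P
    Sr-next Sr≡ P< = trans (toℕ-next (s Sr) (subst (_< suc (n + k)) (sym Sr≡) P<)) (cong suc Sr≡)

    CStep-from : ∀ {th lm x a : Act n} {y y₀ z} → y ≡ y₀ → CStep th lm x y₀ a z → CStep th lm x y a z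
    CStep-from refl st = st

    enable-e : s Cstar ≡ c0 → toℕ (s Sl) ≡ 0 → GStep φ s e (fire s e)
    enable-e C*≡ Sl≡ = fire-step s e λ
      { Cstar Cstar-e → subst (λ y → CsStep y e c1) (sym C*≡) cs-e
      ; Sl    Sl-e    → sl-e Sl≡ (Sl-next Sl≡ (s≤s z≤n)) }

    enable-lam : ∀ i → s (C i) ≡ top → toℕ (s Sl) ≡ suc (toℕ i) → GStep φ s (lam i) (fire s (lam i))
    enable-lam i C-top Sl≡ = fire-step s (lam i) λ
      { (C _) (C-lam _)  → CStep-from C-top c-lm
      ; Sl    (Sl-lam _) → sl-lam i Sl≡ (Sl-next Sl≡ (s≤s (toℕ<n i))) }

    enable-lamb : ∀ i → s (Cb i) ≡ top → toℕ (s Sl) ≡ suc (toℕ i) → GStep φ s (lamb i) (fire s (lamb i))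
    enable-lamb i Cb-top Sl≡ = fire-step s (lamb i) λ
      { (Cb _) (Cb-lam _)  → CStep-from Cb-top c-lm
      ; Sl     (Sl-lamb _) → sl-lamb i Sl≡ (Sl-next Sl≡ (s≤s (toℕ<n i))) }

    enable-theta : ∀ i → s (C i) ≡ top → toℕ (s Sr) ≡ toℕ i → GStep φ s (theta i) (fire s (theta i))
    enable-theta i C-top Sr≡ = fire-step s (theta i) λ
      { (C _) (C-theta _)  → CStep-from C-top c-th
      ; Sr    (Sr-theta _) → sr-theta i Sr≡ (Sr-next Sr≡ (s≤s (toℕ≤n+k i))) }

    enable-thetab : ∀ i → s (Cb i) ≡ top → toℕ (s Sr) ≡ toℕ i → GStep φ s (thetab i) (fire s (thetab i))
    enable-thetab i Cb-top Sr≡ = fire-step s (thetab i) λ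
      { (Cb _) (Cb-theta _)  → CStep-from Cb-top c-th
      ; Sr     (Sr-thetab _) → sr-thetab i Sr≡ (Sr-next Sr≡ (s≤s (toℕ≤n+k i))) }

    enable-literal : ∀ c q → (∀ i → s (C i) ≡ bottom × s (Cb i) ≡ bottom) → toℕ (s Sr) ≡ n + toℕ c →
                     GStep φ s (litAct (φ c q)) (fire s (litAct (φ c q)))
    enable-literal c q all-bottom Sr≡ = fire-step s _ (enabled (φ c q) refl)
      where
      Sr-moves : SrStep φ (s Sr) (litAct (φ c q)) (advance Sr (s Sr))
      Sr-moves = sr-clause c q Sr≡ (Sr-next Sr≡ (m≤n⇒m≤1+n (+-monoʳ-< n (toℕ<n c))))
      enabled : ∀ l → φ c q ≡ l → ∀ p → Alph p (litAct l) → LStep φ p (s p) (litAct l) (advance p (s p))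
      enabled (pos i) _  (C _)  (C-x _)  = CStep-from (proj₁ (all-bottom i)) c-x
      enabled (neg i) _  (Cb _) (Cb-x _) = CStep-from (proj₂ (all-bottom i)) c-x
      enabled (pos i) eq Sr     (Sr-xp _) = subst (λ a → SrStep φ (s Sr) a _) (cong litAct eq) Sr-moves
      enabled (neg i) eq Sr     (Sr-xn _) = subst (λ a → SrStep φ (s Sr) a _) (cong litAct eq) Sr-moves

    enable-b : s Cbstar ≡ d0 → toℕ (s Sr) ≡ n + k → GStep φ s b (fire s b)
    enable-b C̄*≡ Sr≡ = fire-step s b λ
      { Cbstar Cbstar-b → subst (λ y → CbsStep y b (advance Cbstar y)) (sym C̄*≡) cbs-b
      ; Sr     Sr-b     → sr-b Sr≡ (Sr-next Sr≡ ≤-refl) }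

  module _ {s : Global} {ls rs : List (Act n)} (inv : Inv s (sides true ls rs))
           (dead : ∀ a s′ → ¬ GStep φ s a s′) where
    open Inv inv

    left-done : length ls ≡ n
    left-done = ≤-antisym (left-≤n inv) (≮⇒≥ λ ls<n → stuck (fromℕ< ls<n) (toℕ-fromℕ< ls<n))
      where
      stuck : ∀ i → toℕ i ≡ length ls → ⊥
      stuck i i≡ with one-top inv i (inj₂ (≤-reflexive (sym i≡)))
      ... | inj₁ C-top  = dead _ _ (enable-lam i C-top (trans at-Sl (cong suc (sym i≡))))
      ... | inj₂ Cb-top = dead _ _ (enable-lamb i Cb-top (trans at-Sl (cong suc (sym i≡))))

    right-past-variables : n ≤ length rs
    right-past-variables = ≮⇒≥ λ rs<n → stuck (fromℕ< rs<n) (toℕ-fromℕ< rs<n)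
      where
      stuck : ∀ i → toℕ i ≡ length rs → ⊥
      stuck i i≡ with one-top inv i (inj₁ (≤-reflexive (sym i≡)))
      ... | inj₁ C-top  = dead _ _ (enable-theta i C-top (trans at-Sr (sym i≡)))
      ... | inj₂ Cb-top = dead _ _ (enable-thetab i Cb-top (trans at-Sr (sym i≡)))

    all-bottom : ∀ i → s (C i) ≡ bottom × s (Cb i) ≡ bottom
    all-bottom i = both-bottom inv i (≤-trans (toℕ<n i) right-past-variables)
                                     (subst (toℕ i <_) (sym left-done) (toℕ<n i))

    right-past-clauses : n + k ≤ length rs
    right-past-clauses = ≮⇒≥ λ rs<n+k → let c , c≡ = clause-index right-past-variables rs<n+k in
      dead _ _ (enable-literal c fz all-bottom (trans at-Sr (sym c≡)))

    right-done : length rs ≡ suc (n + k)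
    right-done = ≤-antisym (≤-pred (subst (_< _) at-Sr (toℕ<n (s Sr)))) (≤∧≢⇒< right-past-clauses λ eq →
                   dead _ _ (enable-b (Cbstar-idle (≤-reflexive (sym eq))) (trans at-Sr (sym eq))))

  Corr : Global → TState n k → Sides → Set
  Corr _ p0    (sides le _  rs) = le ≡ false × rs ≡ []
  Corr _ (m j) (sides le ls rs) = le ≡ true × length rs ≡ toℕ j × length ls ≡ toℕ j ⊓ n
  Corr s (t i) (sides le ls rs) = le ≡ true × length ls ≡ toℕ i × length rs ≡ suc (toℕ i) × s (C i) ≡ bottom
  Corr s (f i) (sides le ls rs) = le ≡ true × length ls ≡ toℕ i × length rs ≡ suc (toℕ i) × s (Cb i) ≡ bottom

  Simulates : Global → TState n k → Set
  Simulates s t₀ = Σ Sides λ A → Inv s A × Corr s t₀ A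

  ⊓n-≤ : ∀ {x y} → x ≡ y → y ≤ n → x ⊓ n ≡ y
  ⊓n-≤ refl = m≤n⇒m⊓n≡m

  ⊓n-≥ : ∀ {x y} → x ≡ y → n ≤ y → x ⊓ n ≡ n
  ⊓n-≥ refl = m≥n⇒m⊓n≡n

  module _ (unsat : ¬ Satisfiable φ) where

    Inv-step : ∀ {s s′ A a} → Inv s A → GStep φ s a s′ → Preserved s′ A a
    Inv-step {a = theta i}  inv g = step-theta inv i g
    Inv-step {a = thetab i} inv g = step-thetab inv i g
    Inv-step {a = xp i}     inv g = step-xp inv i g
    Inv-step {a = xn i}     inv g = step-xn inv i g
    Inv-step {A = sides false _ _} {e}      inv g = step-e inv g
    Inv-step {A = sides true  _ _} {e}      inv g = ⊥-elim (e-blocked inv g)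
    Inv-step {A = sides false _ _} {eb}     inv g = ⊥-elim (eb-blocked-unstarted inv g)
    Inv-step {A = sides true  _ _} {eb}     inv g = ⊥-elim (eb-blocked inv g)
    Inv-step {A = sides false _ _} {lam i}  inv g = ⊥-elim (lam-blocked inv i g)
    Inv-step {A = sides true  _ _} {lam i}  inv g = step-lam inv i g
    Inv-step {A = sides false _ _} {lamb i} inv g = ⊥-elim (lamb-blocked inv i g)
    Inv-step {A = sides true  _ _} {lamb i} inv g = step-lamb inv i g
    Inv-step {A = sides false _ _} {b}  inv g =
      ⊥-elim (unsat (satisfying-assignment inv (≤-reflexive (sym (RMove-b (right-move inv g Sr-b))))))
    Inv-step {A = sides true  _ _} {b}      inv g = step-b inv (λ ()) g

    Inv-run : ∀ {s s′ A w} → Inv s A → Path (GStep φ) s w s′ →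
              Σ Sides λ A′ → Inv s′ A′ × (linearise A′ ∼ (linearise A ++ w))
    Inv-run {A = A} inv done = A , inv , subst (linearise A ∼_) (sym (++-identityʳ _)) ε
    Inv-run {A = A} inv (step {a = a} {u = w} g path)
      with inv₁ , ∼₁ ← Inv-step inv g
      with A′ , inv′ , ∼₂ ← Inv-run inv₁ path
      = A′ , inv′ , subst (linearise A′ ∼_) (++-assoc (linearise A) (a ∷ []) w) (∼₂ ◅◅ ∼-++ʳ w ∼₁)

    complete : (w : List (Act n)) → FullRun (GStep φ) (GInit n k) w →
               Σ (List (Act n)) λ v → FullRun (TStep φ) p0 v × (v ∼ w)
    complete w (s , path , dead) with Inv-run Inv-init path
    ... | sides false _ _ , inv , _ = ⊥-elim (dead e _ (enable-e (Inv.Cstar-idle inv refl) (Inv.at-Sl inv)))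
    ... | sides true ls rs , inv , lin∼
      with end , T-path , end≡ ← T-run (Inv.matched inv) (left-done inv dead) (right-done inv dead) fz refl
      = e ∷ alternate rs ls , (m end , step (T-e refl) T-path , λ _ _ → end-dead end≡) , lin∼

    Step-simulated : Global → Act n → TState n k → Set
    Step-simulated s a t′ = Σ Global λ s′ → GStep φ s a s′ × Simulates s′ t′

    simulated : ∀ {s s′ A a} t′ → Inv s A → GStep φ s a s′ → Corr s′ t′ (extend A a) → Step-simulated s a t′
    simulated _ inv g corr = _ , g , _ , proj₁ (Inv-step inv g) , corr

    simulate-e : ∀ {s j} → Simulates s p0 → toℕ j ≡ 0 → Step-simulated s e (m j)
    simulate-e {j = j} (_ , inv , refl , refl) j≡ =
      simulated (m j) inv (enable-e (Inv.Cstar-idle inv refl) (Inv.at-Sl inv))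
                (refl , sym j≡ , cong (_⊓ n) (sym j≡))

    simulate-theta : ∀ {s j} i → Simulates s (m j) → toℕ j ≡ toℕ i → Step-simulated s (theta i) (t i)
    simulate-theta {s} i (sides _ ls rs , inv , refl , rs≡ , ls≡) j≡ =
      simulated (t i) inv g (refl , ls≡i , trans (length-∷ʳ rs _) (cong suc rs≡i) , C-bottom g i (C-theta i))
      where
      rs≡i : length rs ≡ toℕ i
      rs≡i = trans rs≡ j≡
      ls≡i : length ls ≡ toℕ i
      ls≡i = trans ls≡ (⊓n-≤ j≡ (<⇒≤ (toℕ<n i)))
      g : GStep φ s (theta i) (fire s (theta i))
      g = enable-theta i (proj₁ (both-top inv i (≤-reflexive rs≡i) (≤-reflexive ls≡i)))
                         (trans (Inv.at-Sr inv) rs≡i)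

    simulate-thetab : ∀ {s j} i → Simulates s (m j) → toℕ j ≡ toℕ i → Step-simulated s (thetab i) (f i)
    simulate-thetab {s} i (sides _ ls rs , inv , refl , rs≡ , ls≡) j≡ =
      simulated (f i) inv g (refl , ls≡i , trans (length-∷ʳ rs _) (cong suc rs≡i) , Cb-bottom g i (Cb-theta i))
      where
      rs≡i : length rs ≡ toℕ i
      rs≡i = trans rs≡ j≡
      ls≡i : length ls ≡ toℕ i
      ls≡i = trans ls≡ (⊓n-≤ j≡ (<⇒≤ (toℕ<n i)))
      g : GStep φ s (thetab i) (fire s (thetab i))
      g = enable-thetab i (proj₂ (both-top inv i (≤-reflexive rs≡i) (≤-reflexive ls≡i)))
                          (trans (Inv.at-Sr inv) rs≡i)

    simulate-lamb : ∀ {s j} i → Simulates s (t i) → toℕ j ≡ suc (toℕ i) → Step-simulated s (lamb i) (m j)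
    simulate-lamb {s} {j} i (sides _ ls rs , inv , refl , ls≡ , rs≡ , C-bot) j≡ =
      simulated (m j) inv (enable-lamb i Cb-top (trans (Inv.at-Sl inv) (cong suc ls≡)))
                (refl , trans rs≡ (sym j≡) ,
                 trans (length-∷ʳ ls _) (trans (cong suc ls≡) (sym (⊓n-≤ j≡ (toℕ<n i)))))
      where
      Cb-top : s (Cb i) ≡ top
      Cb-top = other-top-right (one-top inv i (inj₂ (≤-reflexive ls≡))) C-bot

    simulate-lam : ∀ {s j} i → Simulates s (f i) → toℕ j ≡ suc (toℕ i) → Step-simulated s (lam i) (m j)
    simulate-lam {s} {j} i (sides _ ls rs , inv , refl , ls≡ , rs≡ , Cb-bot) j≡ =
      simulated (m j) inv (enable-lam i C-top (trans (Inv.at-Sl inv) (cong suc ls≡)))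
                (refl , trans rs≡ (sym j≡) ,
                 trans (length-∷ʳ ls _) (trans (cong suc ls≡) (sym (⊓n-≤ j≡ (toℕ<n i)))))
      where
      C-top : s (C i) ≡ top
      C-top = other-top-left (one-top inv i (inj₂ (≤-reflexive ls≡))) Cb-bot

    simulate-clause : ∀ {s j j′} c q → Simulates s (m j) → toℕ j ≡ n + toℕ c → toℕ j′ ≡ suc (n + toℕ c) →
                      Step-simulated s (litAct (φ c q)) (m j′)
    simulate-clause {s} {j′ = j′} c q (sides _ ls rs , inv , refl , rs≡ , ls≡) j≡ j′≡ =
      simulated (m j′) inv (enable-literal c q vars-bottom (trans (Inv.at-Sr inv) rs≡n+c))
                (subst (Corr (fire s (litAct (φ c q))) (m j′)) (sym (extend-literal (φ c q)))
                       (refl , trans (length-∷ʳ rs _) (trans (cong suc rs≡n+c) (sym j′≡)) ,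
                        trans ls≡n (sym (⊓n-≥ j′≡ (m≤n⇒m≤1+n (m≤m+n n (toℕ c)))))))
      where
      rs≡n+c : length rs ≡ n + toℕ c
      rs≡n+c = trans rs≡ j≡
      ls≡n : length ls ≡ n
      ls≡n = trans ls≡ (⊓n-≥ j≡ (m≤m+n n (toℕ c)))
      vars-bottom : ∀ i → s (C i) ≡ bottom × s (Cb i) ≡ bottom
      vars-bottom i = both-bottom inv i (≤-trans (toℕ<n i) (subst (n ≤_) (sym rs≡n+c) (m≤m+n n (toℕ c))))
                                        (subst (toℕ i <_) (sym ls≡n) (toℕ<n i))

    simulate-b : ∀ {s j j′} → Simulates s (m j) → toℕ j ≡ n + k → toℕ j′ ≡ suc (n + k) →
                 Step-simulated s b (m j′)
    simulate-b {j′ = j′} (sides _ ls rs , inv , refl , rs≡ , ls≡) j≡ j′≡ =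
      simulated (m j′) inv (enable-b (Inv.Cbstar-idle inv (≤-reflexive rs≡n+k)) (trans (Inv.at-Sr inv) rs≡n+k))
                (refl , trans (length-∷ʳ rs _) (trans (cong suc rs≡n+k) (sym j′≡)) ,
                 trans ls≡ (trans (⊓n-≥ j≡ (m≤m+n n k)) (sym (⊓n-≥ j′≡ (m≤n⇒m≤1+n (m≤m+n n k))))))
      where
      rs≡n+k : length rs ≡ n + k
      rs≡n+k = trans rs≡ j≡

    simulate-step : ∀ {s t₀ a t′} → Simulates s t₀ → TStep φ t₀ a t′ → Step-simulated s a t′
    simulate-step sim (T-e j≡)              = simulate-e sim j≡
    simulate-step sim (T-theta i j≡)        = simulate-theta i sim j≡
    simulate-step sim (T-thetab i j≡)       = simulate-thetab i sim j≡
    simulate-step sim (T-lamb i j≡)         = simulate-lamb i sim j≡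
    simulate-step sim (T-lam i j≡)          = simulate-lam i sim j≡
    simulate-step sim (T-clause c q j≡ j′≡) = simulate-clause c q sim j≡ j′≡
    simulate-step sim (T-b j≡ j′≡)          = simulate-b sim j≡ j′≡

    simulate : ∀ {s t₀ w t′} → Simulates s t₀ → Path (TStep φ) t₀ w t′ → (∀ a t″ → ¬ TStep φ t′ a t″) →
               FullRun (GStep φ) s w
    simulate {s} (sides le ls rs , inv , corr) done t-dead with T-stuck t-dead
    simulate {s} (sides le ls rs , inv , refl , rs≡ , ls≡) done t-dead | j , refl , j≡ =
      s , done , final-dead inv (trans ls≡ (⊓n-≥ j≡ (m≤n⇒m≤1+n (m≤m+n n k)))) (trans rs≡ j≡)
    simulate sim (step tstep path) t-dead
      with s′ , g , sim′ ← simulate-step sim tstep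
      with sf , gpath , g-dead ← simulate sim′ path t-dead
      = sf , step g gpath , g-dead

    sound : (w : List (Act n)) → FullRun (TStep φ) p0 w → FullRun (GStep φ) (GInit n k) w
    sound w (_ , path , t-dead) = simulate (sides false [] [] , Inv-init , refl , refl) path t-dead

lemma8p4 : (n k : ℕ) (φ : Formula n k) → ¬ Satisfiable φ →
    SoundComplete φ (TStep φ) p0
lemma8p4 n k φ unsat = sound unsat , complete unsat
  where open Pφ n k φ
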